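{- For any string $S$ and any interval $[x,y]$ with $1 \leq x \leq y \leq |S|$: if $[x,y] \in \mathcal{RS}_S$ then $[x,y] \in \mathsf{SUS}_S(y)$, and if $[x,y] \in \mathcal{LS}_S$ then $[x,y] \in \mathsf{SUS}_S(x)$.
   Context: For a string $S$ of length $n$ and $1 \le i \le j \le n$, $S[i..j]$ is the substring from position $i$ to position $j$; a non-empty substring $w$ is unique if it occurs exactly once in $S$ and repeating if it occurs at least twice; an interval $[i,j]$ is called unique/repeating according to $S[i..j]$. An interval $[i,j]$ is a minimal unique substring (MUS) of $S$ if $S[i..j]$ is unique and every proper substring $S[i'..j']$ ($i\le i'$, $j'\le j$, $j'-i'<j-i$) is repeating; $\mathcal{M}_S$ is the set of all MUS intervals. For intervals, $[s,t]\subset[i,j]$ means $i\le s$ and $t\le j$. An interval $[i,j]$ is a shortest unique substring (SUS) for $[s,t]$ if $S[i..j]$ is unique, $[s,t]\subset[i,j]$, and $S[i'..j']$ is repeating for every $[i',j']\supset[s,t]$ with $j'-i'<j-i$. $\mathsf{SUS}_S(p)$ is the set of SUSs for $[p,p]$ and $\mathcal{PS}_S=\bigcup_{p=1}^n\mathsf{SUS}_S(p)$. Define $\mathcal{LS}_S=\mathcal{PS}_S\cap\{[x,y]\notin\mathcal{M}_S : \exists i \text{ with } x<i\le y,\ [i,y]\in\mathcal{M}_S\}$ and $\mathcal{RS}_S=\mathcal{PS}_S\cap\{[x,y]\notin\mathcal{M}_S : \exists j \text{ with } x\le j<y,\ [x,j]\in\mathcal{M}_S\}$. -}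

module Defs where

open import Data.Nat using (ℕ; suc; _∸_; _≤_; _<_)
open import Data.List using (List; take; drop; length)
open import Data.Product using (_×_; ∃; ∃-syntax; Σ-syntax)
open import Relation.Binary.PropositionalEquality using (_≡_; _≢_)

-- Strings over an arbitrary alphabet A are lists; positions are 1-based naturals.

-- S[i..j] (meaningful when 1 ≤ i ≤ j ≤ |S|)
substr : {A : Set} → List A → ℕ → ℕ → List A
substr S i j = take (suc j ∸ i) (drop (i ∸ 1) S)

IsInterval : {A : Set} → List A → ℕ → ℕ → Set
IsInterval S i j = (1 ≤ i) × (i ≤ j) × (j ≤ length S)

-- w occurs in S starting at position k (w non-empty in all uses)
OccursAt : {A : Set} → List A → List A → ℕ → Set
OccursAt S w k = IsInterval S k (k + length w ∸ 1) × (substr S k (k + length w ∸ 1) ≡ w)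
  where open import Data.Nat using (_+_)

UniqueStr : {A : Set} → List A → List A → Set
UniqueStr S w = ∃[ k ] (OccursAt S w k × (∀ k' → OccursAt S w k' → k' ≡ k))

RepeatingStr : {A : Set} → List A → List A → Set
RepeatingStr S w = ∃[ k ] ∃[ k' ] (k ≢ k' × OccursAt S w k × OccursAt S w k')

UniqueInt : {A : Set} → List A → ℕ → ℕ → Set
UniqueInt S i j = UniqueStr S (substr S i j)

RepeatingInt : {A : Set} → List A → ℕ → ℕ → Set
RepeatingInt S i j = RepeatingStr S (substr S i j)

IsMUS : {A : Set} → List A → ℕ → ℕ → Set
IsMUS S i j =
  IsInterval S i j × UniqueInt S i j ×
  (∀ i' j' → i ≤ i' → i' ≤ j' → j' ≤ j → j' ∸ i' < j ∸ i → RepeatingInt S i' j')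

IsSUSFor : {A : Set} → List A → ℕ → ℕ → ℕ → ℕ → Set
IsSUSFor S s t i j =
  IsInterval S i j × UniqueInt S i j × i ≤ s × t ≤ j ×
  (∀ i' j' → IsInterval S i' j' → i' ≤ s → t ≤ j' → j' ∸ i' < j ∸ i → RepeatingInt S i' j')

InSUS : {A : Set} → List A → ℕ → ℕ → ℕ → Set
InSUS S p i j = IsSUSFor S p p i j

InPS : {A : Set} → List A → ℕ → ℕ → Set
InPS S i j = ∃[ p ] ((1 ≤ p) × (p ≤ length S) × InSUS S p i j)

InLS : {A : Set} → List A → ℕ → ℕ → Set
InLS S x y = InPS S x y × ¬ IsMUS S x y × ∃[ i ] ((x < i) × (i ≤ y) × IsMUS S i y)
  where open import Relation.Nullary using (¬_)

InRS : {A : Set} → List A → ℕ → ℕ → Set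
InRS S x y = InPS S x y × ¬ IsMUS S x y × ∃[ j ] ((x ≤ j) × (j < y) × IsMUS S x j)
  where open import Relation.Nullary using (¬_)

module Submission where

-- Let [x,y] ∈ SUS_S(p).  If [x,y] ∈ RS_S, some MUS [x,j] with j < y
-- exists.  Were p < y, the strictly shorter interval [x,y-1] would still
-- contain p, so by minimality of the SUS it is repeating; but then its
-- subinterval [x,j] is repeating too, contradicting the uniqueness of the
-- MUS.  Hence p = y, i.e. [x,y] ∈ SUS_S(y).  The LS case is the mirror
-- image: a MUS [i,y] with x < i forces p = x.
--
-- The only real ingredient is "a substring of a repeating substring is
-- repeating".  We prove it on 0-based windows  take n (drop k S):  a
-- window of a window is a window (window-window), so every occurrence of
-- w yields an occurrence of any window of w at a shifted position
-- (occurs-window), and distinct occurrences stay distinct.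

open import Defs
open import Data.Nat using (ℕ; suc; _+_; _∸_; _⊓_; _≤_; _<_; z≤n; s≤s)
open import Data.Nat.Properties
open import Data.List using (List; length; take; drop)
open import Data.List.Properties using (length-take; length-drop; take-take; take-drop; drop-drop)
open import Data.Product using (_×_; _,_; proj₁; proj₂)
open import Data.Sum using (inj₁; inj₂)
open import Data.Empty using (⊥-elim)
open import Relation.Nullary using (¬_)
open import Relation.Binary.PropositionalEquality

private
  variable
    A : Set

-- The window of length n starting after k characters (0-based offset).
-- Note that  substr S (suc i) j  is, by definition,  window S i (j ∸ i).
window : List A → ℕ → ℕ → List A
window S k n = take n (drop k S)

length-window : (S : List A) (k n : ℕ) → k + n ≤ length S → length (window S k n) ≡ n
length-window S k n fits = begin
  length (take n (drop k S))  ≡⟨ length-take n (drop k S) ⟩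
  n ⊓ length (drop k S)       ≡⟨ cong (n ⊓_) (length-drop k S) ⟩
  n ⊓ (length S ∸ k)          ≡⟨ m≤n⇒m⊓n≡m (m+n≤o⇒m≤o∸n n (subst (_≤ length S) (+-comm k n) fits)) ⟩
  n                           ∎
  where open ≡-Reasoning

window-window : (S : List A) (k m u n : ℕ) → u + n ≤ m →
  window (window S k m) u n ≡ window S (k + u) n
window-window S k m u n inside = begin
  take n (drop u (take m (drop k S)))     ≡⟨ take-drop n u (take m (drop k S)) ⟩
  drop u (take (u + n) (take m (drop k S))) ≡⟨ cong (drop u) (take-take (u + n) m (drop k S)) ⟩
  drop u (take ((u + n) ⊓ m) (drop k S))  ≡⟨ cong (λ t → drop u (take t (drop k S))) (m≤n⇒m⊓n≡m inside) ⟩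
  drop u (take (u + n) (drop k S))        ≡⟨ take-drop n u (drop k S) ⟨
  take n (drop u (drop k S))              ≡⟨ cong (take n) (drop-drop k u S) ⟩
  take n (drop (k + u) S)                 ∎
  where open ≡-Reasoning

occurs⇒window : (S w : List A) (k : ℕ) → OccursAt S w (suc k) →
  k + length w ≤ length S × window S k (length w) ≡ w
occurs⇒window S w k ((_ , _ , fits) , eq) =
  fits , trans (cong (window S k) (sym (m+n∸m≡n k (length w)))) eq

window⇒occurs : (S : List A) (k n : ℕ) → k + n ≤ length S → 1 ≤ n →
  OccursAt S (window S k n) (suc k)
window⇒occurs S k n fits 1≤n
  rewrite length-window S k n fits =
  (s≤s z≤n , subst (_≤ k + n) (+-comm k 1) (+-monoʳ-≤ k 1≤n) , fits) ,
  cong (window S k) (m+n∸m≡n k n)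

occurs-window : (S w : List A) (k u n : ℕ) → u + n ≤ length w → 1 ≤ n →
  OccursAt S w (suc k) → OccursAt S (window w u n) (suc (k + u))
occurs-window S w k u n inside 1≤n occ =
  subst (λ v → OccursAt S v (suc (k + u))) same-window
    (window⇒occurs S (k + u) n fits 1≤n)
  where
  w-fits : k + length w ≤ length S
  w-fits = proj₁ (occurs⇒window S w k occ)
  w-is-window : window S k (length w) ≡ w
  w-is-window = proj₂ (occurs⇒window S w k occ)
  fits : k + u + n ≤ length S
  fits = ≤-trans (≤-reflexive (+-assoc k u n)) (≤-trans (+-monoʳ-≤ k inside) w-fits)
  same-window : window S (k + u) n ≡ window w u n
  same-window = begin
    window S (k + u) n                  ≡⟨ window-window S k (length w) u n inside ⟨
    window (window S k (length w)) u n  ≡⟨ cong (λ v → window v u n) w-is-window ⟩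
    window w u n                        ∎
    where open ≡-Reasoning

-- A non-empty window of a repeating string is repeating.  (Occurrence
-- positions are ≥ 1, which the patterns  s≤s z≤n  make explicit.)
repeating-window : (S w : List A) (u n : ℕ) → u + n ≤ length w → 1 ≤ n →
  RepeatingStr S w → RepeatingStr S (window w u n)
repeating-window S w u n inside 1≤n
  (suc k , suc k' , k≢k' , occ@((s≤s z≤n , _) , _) , occ'@((s≤s z≤n , _) , _)) =
  suc (k + u) , suc (k' + u) , shifted-distinct ,
  occurs-window S w k u n inside 1≤n occ , occurs-window S w k' u n inside 1≤n occ'
  where
  shifted-distinct : ¬ suc (k + u) ≡ suc (k' + u)
  shifted-distinct eq = k≢k' (cong suc (+-cancelʳ-≡ u k k' (suc-injective eq)))

∸-split : (i k j : ℕ) → i ≤ k → k ≤ j → (k ∸ i) + (j ∸ k) ≡ j ∸ i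
∸-split i k j i≤k k≤j = +-cancelˡ-≡ i _ _ (begin
  i + ((k ∸ i) + (j ∸ k))  ≡⟨ +-assoc i (k ∸ i) (j ∸ k) ⟨
  i + (k ∸ i) + (j ∸ k)    ≡⟨ cong (_+ (j ∸ k)) (m+[n∸m]≡n i≤k) ⟩
  k + (j ∸ k)              ≡⟨ m+[n∸m]≡n k≤j ⟩
  j                        ≡⟨ m+[n∸m]≡n (≤-trans i≤k k≤j) ⟨
  i + (j ∸ i)              ∎)
  where open ≡-Reasoning

repeating-subinterval : (S : List A) (i j i' j' : ℕ) → 1 ≤ i → j ≤ length S →
  i ≤ i' → i' ≤ j' → j' ≤ j → RepeatingInt S i j → RepeatingInt S i' j'
repeating-subinterval S (suc i) j (suc i') j' _ j≤|S| (s≤s i≤i') i'<j' j'≤j rep =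
  subst (RepeatingStr S) same-window
    (repeating-window S (window S i (j ∸ i)) (i' ∸ i) (j' ∸ i') inside
      (m<n⇒0<n∸m i'<j') rep)
  where
  i≤j : i ≤ j
  i≤j = ≤-trans i≤i' (≤-trans (n≤1+n i') (≤-trans i'<j' j'≤j))
  within : (i' ∸ i) + (j' ∸ i') ≤ j ∸ i
  within = begin
    (i' ∸ i) + (j' ∸ i')  ≡⟨ ∸-split i i' j' i≤i' (≤-trans (n≤1+n i') i'<j') ⟩
    j' ∸ i                ≤⟨ ∸-monoˡ-≤ i j'≤j ⟩
    j ∸ i                 ∎
    where open ≤-Reasoning
  inside : (i' ∸ i) + (j' ∸ i') ≤ length (window S i (j ∸ i))
  inside = subst ((i' ∸ i) + (j' ∸ i') ≤_)
    (sym (length-window S i (j ∸ i) (subst (_≤ length S) (sym (m+[n∸m]≡n i≤j)) j≤|S|)))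
    within
  same-window : window (window S i (j ∸ i)) (i' ∸ i) (j' ∸ i') ≡ window S i' (j' ∸ i')
  same-window = trans (window-window S i (j ∸ i) (i' ∸ i) (j' ∸ i') within)
                      (cong (λ o → window S o (j' ∸ i')) (m+[n∸m]≡n i≤i'))

unique-not-repeating : (S w : List A) → UniqueStr S w → ¬ RepeatingStr S w
unique-not-repeating S w (k , _ , only-k) (k₁ , k₂ , k₁≢k₂ , occ₁ , occ₂) =
  k₁≢k₂ (trans (only-k k₁ occ₁) (sym (only-k k₂ occ₂)))

-- If [x,y] ∈ SUS_S(p) and some [x,j] with j < y is unique, then p = y:
-- otherwise the shorter [x,y-1] ∋ p would be repeating, and with it [x,j].
sus-right-endpoint : (S : List A) (p x y j : ℕ) → InSUS S p x y →
  x ≤ j → j < y → UniqueInt S x j → p ≡ y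
sus-right-endpoint S p x y j ((1≤x , _ , y≤|S|) , _ , x≤p , p≤y , minimal) x≤j j<y uniq
  with m≤n⇒m<n∨m≡n p≤y
... | inj₂ p≡y = p≡y
... | inj₁ (s≤s {n = y₀} p≤y₀) =
  ⊥-elim (unique-not-repeating S _ uniq
    (repeating-subinterval S x y₀ x j 1≤x y₀≤|S| ≤-refl x≤j (≤-pred j<y) shorter-repeats))
  where
  y₀≤|S| : y₀ ≤ length S
  y₀≤|S| = ≤-trans (n≤1+n y₀) y≤|S|
  x≤y₀ : x ≤ y₀
  x≤y₀ = ≤-trans x≤p p≤y₀
  shorter-repeats : RepeatingInt S x y₀
  shorter-repeats = minimal x y₀ (1≤x , x≤y₀ , y₀≤|S|) x≤p p≤y₀
    (∸-monoˡ-< (n<1+n y₀) x≤y₀)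

-- Mirror image: if [x,y] ∈ SUS_S(p) and some [i,y] with x < i is unique,
-- then p = x, since otherwise the shorter [x+1,y] ∋ p would be repeating.
sus-left-endpoint : (S : List A) (p x y i : ℕ) → InSUS S p x y →
  x < i → i ≤ y → UniqueInt S i y → p ≡ x
sus-left-endpoint S p x y i ((_ , _ , y≤|S|) , _ , x≤p , p≤y , minimal) x<i i≤y uniq
  with m≤n⇒m<n∨m≡n x≤p
... | inj₂ x≡p = sym x≡p
... | inj₁ x<p =
  ⊥-elim (unique-not-repeating S _ uniq
    (repeating-subinterval S (suc x) y i y (s≤s z≤n) y≤|S| x<i i≤y ≤-refl shorter-repeats))
  where
  x<y : x < y
  x<y = ≤-trans x<p p≤y
  shorter-repeats : RepeatingInt S (suc x) y
  shorter-repeats = minimal (suc x) y (s≤s z≤n , x<y , y≤|S|) x<p p≤y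
    (∸-monoʳ-< (n<1+n x) x<y)

lemma2 : {A : Set} (S : List A) (x y : ℕ) → 1 ≤ x → x ≤ y → y ≤ length S →
    (InRS S x y → InSUS S y x y) × (InLS S x y → InSUS S x x y)
lemma2 S x y _ _ _ = from-RS , from-LS
  where
  from-RS : InRS S x y → InSUS S y x y
  from-RS ((p , _ , _ , sus) , _ , j , x≤j , j<y , (_ , uniq , _)) =
    subst (λ q → InSUS S q x y) (sus-right-endpoint S p x y j sus x≤j j<y uniq) sus
  from-LS : InLS S x y → InSUS S x x y
  from-LS ((p , _ , _ , sus) , _ , i , x<i , i≤y , (_ , uniq , _)) =
    subst (λ q → InSUS S q x y) (sus-left-endpoint S p x y i sus x<i i≤y uniq) sus
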